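{- Let $k,\ell\ge0$ and $1\le m\le n$ be integers, let $\pi=\pi_1\cdots\pi_n\in\mathfrak{S}_{m,n}$ and let $i\in[n]$ with $\pi_i>0$. Consider the street with spots $1,\dots,n$ in which exactly the spots $u$ with $0<\pi_u<\pi_i$ are occupied (this is the state of the street when car $\pi_i$ enters, for any $(k,\ell)$-pullback $(m,n)$-parking function with outcome $\pi$). Let $\mathrm{B}(\pi_i)$ be the number of preferences $a$ for car $\pi_i$ such that car $\pi_i$ finds spot $a$ occupied and, under the $(k,\ell)$-pullback rule, backs into spot $i$ (necessarily $a>i$). Then $\mathrm{B}(\pi_i)=\min(\mathrm{Right}(\pi_i),k)$. (By convention $\mathrm{B}(0)=0$.)
   Context: $(k,\ell)$-pullback parking rule: a car with preference $a$ drives to spot $a$ and parks there if it is empty; otherwise it checks spots $a-1,a-2,\dots,a-k$ in this order (stopping if it reaches the start of the street) and parks in the first empty one; if none is found, it checks spots $a+1,\dots,a+\ell$ in order (not beyond spot $n$) and parks in the first empty one; otherwise it fails to park. A $(k,\ell)$-pullback $(m,n)$-parking function is a list $\alpha\in[n]^m$ of preferences of cars $1,\dots,m$ (entering in this order) under which all cars park. $\mathfrak{S}_{m,n}$ is the set of words $\pi_1\cdots\pi_n$ that are permutations of the multiset of $n-m$ zeros and the elements of $[m]$; the outcome of a parking function has $\pi_u=j$ if car $j$ parks in spot $u$ and $\pi_u=0$ if spot $u$ is vacant. $\mathrm{Right}(\pi_i)$ is the largest $x\ge0$ such that $0<\pi_t<\pi_i$ for all $i+1\le t\le i+x$ (with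 $i+x\le n$). -}

module Defs where

open import Data.Nat using (ℕ; zero; suc; _+_; _∸_; _<_; _≤_; _<ᵇ_; _≤ᵇ_)
open import Data.Bool using (Bool; true; false; if_then_else_; _∧_)
open import Data.Maybe using (Maybe; just; nothing)
open import Data.List using (List; []; _∷_; _++_; map; filter; upTo; replicate; length)
open import Data.Vec using (Vec; toList)
open import Data.List.Relation.Binary.Permutation.Propositional using (_↭_)
open import Relation.Nullary using (Dec; yes; no)
open import Relation.Nullary.Decidable using (⌊_⌋)
import Data.Nat as ℕ

inS : (m n : ℕ) → Vec ℕ n → Set
inS m n π = toList π ↭ (replicate (n ∸ m) 0 ++ map suc (upTo m))

-- 1-indexed lookup in a list (value 0 outside the range; only used on 1..n)
at : List ℕ → ℕ → ℕ
at []       _             = 0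
at (x ∷ xs) zero          = 0
at (x ∷ xs) (suc zero)    = x
at (x ∷ xs) (suc (suc u)) = at xs (suc u)

occupiedBefore : ∀ {n} → Vec ℕ n → (c u : ℕ) → Bool
occupiedBefore π c u = (0 <ᵇ at (toList π) u) ∧ (at (toList π) u <ᵇ c)

firstFree : (ℕ → Bool) → List ℕ → Maybe ℕ
firstFree occ [] = nothing
firstFree occ (u ∷ us) = if occ u then firstFree occ us else just u

backSpots : (a k : ℕ) → List ℕ
backSpots a k = map (λ j → a ∸ j) (filter (λ j → j ℕ.<? a) (map suc (upTo k)))

fwdSpots : (n a ℓ : ℕ) → List ℕ
fwdSpots n a ℓ = filter (λ u → u ℕ.≤? n) (map (λ j → a + suc j) (upTo ℓ))

-- (k,ℓ)-pullback rule on a street of n spots with occupancy `occ`,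
-- for a car with preference a: the spot it parks in (nothing = fails)
pullbackPark : (k ℓ n : ℕ) → (ℕ → Bool) → (a : ℕ) → Maybe ℕ
pullbackPark k ℓ n occ a =
  if occ a then firstFree occ (backSpots a k ++ fwdSpots n a ℓ) else just a

countB : (ℕ → Bool) → List ℕ → ℕ
countB p [] = 0
countB p (x ∷ xs) = if p x then suc (countB p xs) else countB p xs

isJust≡ : Maybe ℕ → ℕ → Bool
isJust≡ nothing  i = false
isJust≡ (just u) i = ⌊ u ℕ.≟ i ⌋

Bcount : (k ℓ n : ℕ) → Vec ℕ n → (i : ℕ) → ℕ
Bcount k ℓ n π i =
  countB (λ a → occ a ∧ (i <ᵇ a) ∧ isJust≡ (pullbackPark k ℓ n occ a) i)
         (map suc (upTo n))
  where
    occ : ℕ → Bool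
    occ = occupiedBefore π (at (toList π) i)

-- Right(π_i): largest x ≥ 0 with 0 < π_t < π_i for all i+1 ≤ t ≤ i+x ≤ n.
-- Computed by scanning spots i+1, i+2, ... while they satisfy the condition.
rightScan : (ℕ → Bool) → (n t fuel : ℕ) → ℕ
rightScan p n t zero = 0
rightScan p n t (suc fuel) =
  if (t ≤ᵇ n) ∧ p t then suc (rightScan p n (suc t) fuel) else 0

Right : (n : ℕ) → Vec ℕ n → (i : ℕ) → ℕ
Right n π i = rightScan (occupiedBefore π (at (toList π) i)) n (suc i) n

{-# OPTIONS --safe #-}
-- Spot i is vacant when car π_i arrives, the spots i+1, …, i+R with R = Right(π_i)
-- are occupied, and spot i+R+1, if it exists, is vacant. A car preferring an occupied
-- spot a > i scans a-1, a-2, … downwards, so it backs into i exactly when a - i ≤ k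
-- and every spot strictly between i and a is occupied, that is, when
-- i < a ≤ i + min(R, k). Nothing about π is used beyond the vacancy of spot i.

module Submission where

open import Defs
open import Data.Nat
  using (ℕ; zero; suc; _+_; _∸_; _⊓_; _≤_; _<_; _≥_; _<ᵇ_; _≤ᵇ_; z≤n; z<s; s≤s; s≤s⁻¹)
open import Data.Nat.Properties
open import Data.Bool using (Bool; true; false; _∧_; T)
open import Data.Bool.Properties using (∧-zeroʳ; ∧-conicalˡ; ∧-conicalʳ)
open import Data.Maybe using (just; nothing)
open import Data.Maybe.Properties using (just-injective)
open import Data.Vec using (Vec; toList)
open import Data.List using (List; []; _∷_; _++_; map; upTo; applyUpTo; length)
open import Data.List.Properties using (map-upTo; length-applyUpTo)
open import Data.List.Membership.Propositional using (_∈_)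
open import Data.List.Membership.Propositional.Properties
  using (∈-applyUpTo⁺; ∈-applyUpTo⁻; ∈-map⁻; ∈-filter⁻; ∈-++⁻; ∈-map∘filter⁺; ∈-map∘filter⁻)
open import Data.List.Relation.Unary.All as All using (All)
open import Data.List.Relation.Unary.All.Properties using (applyUpTo⁺₁)
open import Data.List.Relation.Unary.Any using (here; there)
open import Data.List.Relation.Unary.AllPairs as AllPairs using (AllPairs; _∷_)
import Data.List.Relation.Unary.AllPairs.Properties as AllPairs
open import Data.Product using (_×_; _,_; proj₁; proj₂; ∃-syntax)
open import Data.Sum using (inj₁; inj₂)
open import Data.Unit using (tt)
open import Function using (_∘_)
open import Relation.Nullary using (yes; no; contradiction)
open import Relation.Nullary.Decidable using (dec-true; dec-false; isYes≗does)
open import Relation.Binary.PropositionalEquality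
  using (_≡_; _≢_; refl; sym; trans; cong; cong₂; subst; subst₂; module ≡-Reasoning)

countB-++ : ∀ (p : ℕ → Bool) xs ys → countB p (xs ++ ys) ≡ countB p xs + countB p ys
countB-++ p []       ys = refl
countB-++ p (x ∷ xs) ys with p x
... | true  = cong suc (countB-++ p xs ys)
... | false = countB-++ p xs ys

countB-none : ∀ {p : ℕ → Bool} {xs} → All (λ x → p x ≡ false) xs → countB p xs ≡ 0
countB-none All.[]         = refl
countB-none (px All.∷ pxs) rewrite px = countB-none pxs

countB-all : ∀ {p : ℕ → Bool} {xs} → All (λ x → p x ≡ true) xs → countB p xs ≡ length xs
countB-all All.[]         = refl
countB-all (px All.∷ pxs) rewrite px = cong suc (countB-all pxs)

applyUpTo-+ : ∀ {A : Set} (f : ℕ → A) m n →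
              applyUpTo f (m + n) ≡ applyUpTo f m ++ applyUpTo (f ∘ (m +_)) n
applyUpTo-+ f zero    n = refl
applyUpTo-+ f (suc m) n = cong (f 0 ∷_) (applyUpTo-+ (f ∘ suc) m n)

countB-applyUpTo-block : ∀ (p : ℕ → Bool) f a b c →
                         (∀ {j} → j < a → p (f j) ≡ false) →
                         (∀ {j} → j < b → p (f (a + j)) ≡ true) →
                         (∀ {j} → j < c → p (f (a + b + j)) ≡ false) →
                         countB p (applyUpTo f (a + b + c)) ≡ b
countB-applyUpTo-block p f a b c before inside after = begin
  countB p (applyUpTo f (a + b + c))
    ≡⟨ cong (countB p) (trans (applyUpTo-+ f (a + b) c) (cong (_++ zs) (applyUpTo-+ f a b))) ⟩
  countB p ((xs ++ ys) ++ zs)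
    ≡⟨ trans (countB-++ p (xs ++ ys) zs) (cong (_+ countB p zs) (countB-++ p xs ys)) ⟩
  countB p xs + countB p ys + countB p zs
    ≡⟨ cong₂ _+_ (cong₂ _+_ (countB-none (applyUpTo⁺₁ f a before))
                            (trans (countB-all (applyUpTo⁺₁ (f ∘ (a +_)) b inside))
                                   (length-applyUpTo (f ∘ (a +_)) b)))
                 (countB-none (applyUpTo⁺₁ (f ∘ (a + b +_)) c after)) ⟩
  b + 0
    ≡⟨ +-identityʳ b ⟩
  b ∎
  where
  open ≡-Reasoning
  xs ys zs : List ℕ
  xs = applyUpTo f a
  ys = applyUpTo (f ∘ (a +_)) b
  zs = applyUpTo (f ∘ (a + b +_)) c

firstFree-sound : ∀ {occ : ℕ → Bool} xs {v} → firstFree occ xs ≡ just v → v ∈ xs × occ v ≡ false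
firstFree-sound {occ} (x ∷ xs) found with occ x in ox
... | true  = let v∈xs , ov = firstFree-sound xs found in there v∈xs , ov
... | false with refl ← found = here refl , ox

firstFree-++ : ∀ {occ : ℕ → Bool} xs ys {v} → firstFree occ xs ≡ just v →
               firstFree occ (xs ++ ys) ≡ just v
firstFree-++ {occ} (x ∷ xs) ys found with occ x
... | true  = firstFree-++ xs ys found
... | false = found

firstFree-descending : ∀ {occ : ℕ → Bool} {xs u} → AllPairs _≥_ xs → u ∈ xs → occ u ≡ false →
                       ∃[ v ] firstFree occ xs ≡ just v × u ≤ v
firstFree-descending (_ ∷ _) (here refl) ou rewrite ou = _ , refl , ≤-refl
firstFree-descending {occ} {x ∷ _} (x≥xs ∷ xs↓) (there u∈xs) ou with occ x
... | true  = firstFree-descending xs↓ u∈xs ou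
... | false = x , refl , All.lookup x≥xs u∈xs

backSpots-descending : ∀ a k → AllPairs _≥_ (backSpots a k)
backSpots-descending a k =
  AllPairs.map⁺ (AllPairs.map (∸-monoʳ-≤ a) (AllPairs.filter⁺ (_<? a) increasing))
  where
  increasing : AllPairs _≤_ (map suc (upTo k))
  increasing rewrite map-upTo suc k = AllPairs.applyUpTo⁺₁ suc k (λ i<j _ → s≤s (<⇒≤ i<j))

∈-backSpots⁺ : ∀ {a k u} → 0 < u → u < a → a ≤ u + k → u ∈ backSpots a k
∈-backSpots⁺ {a} {k} {u} 0<u u<a a≤u+k =
  ∈-map∘filter⁺ (a ∸_) (_<? a)
    (a ∸ u , a∸u∈ , sym (m∸[m∸n]≡n (<⇒≤ u<a)) , ∸-monoʳ-< 0<u (<⇒≤ u<a))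
  where
  1+[a∸1+u]≡a∸u : suc (a ∸ suc u) ≡ a ∸ u
  1+[a∸1+u]≡a∸u = sym (+-∸-assoc 1 u<a)
  a∸u∈ : a ∸ u ∈ map suc (upTo k)
  a∸u∈ rewrite map-upTo suc k =
    subst (_∈ applyUpTo suc k) 1+[a∸1+u]≡a∸u
      (∈-applyUpTo⁺ suc (subst (_≤ k) (sym 1+[a∸1+u]≡a∸u) (m≤n+o⇒m∸n≤o a u a≤u+k)))

∈-backSpots⁻ : ∀ a k {u} → u ∈ backSpots a k → u < a × a ≤ u + k
∈-backSpots⁻ a k u∈
  with j , j∈ , refl , j<a ← ∈-map∘filter⁻ (a ∸_) (_<? a) {xs = map suc (upTo k)} u∈
  with i , i<k , refl ← ∈-applyUpTo⁻ suc (subst (j ∈_) (map-upTo suc k) j∈)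
  = ∸-monoʳ-< z<s (<⇒≤ j<a)
  , ≤-trans (≤-reflexive (sym (m∸n+n≡m (<⇒≤ j<a)))) (+-monoʳ-≤ (a ∸ suc i) i<k)

∈-fwdSpots⁻ : ∀ n a ℓ {u} → u ∈ fwdSpots n a ℓ → a < u
∈-fwdSpots⁻ n a ℓ u∈
  with u∈map , _ ← ∈-filter⁻ (_≤? n) {xs = map (λ j → a + suc j) (upTo ℓ)} u∈
  with _ , _ , refl ← ∈-map⁻ (λ j → a + suc j) u∈map
  = m<m+n a z<s

firstFree-backSpots-≥ : ∀ {occ : ℕ → Bool} a k {u} → occ u ≡ false → 0 < u → u < a → a ≤ u + k →
                        ∃[ v ] firstFree occ (backSpots a k) ≡ just v × u ≤ v
firstFree-backSpots-≥ a k ou 0<u u<a a≤u+k =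
  firstFree-descending (backSpots-descending a k) (∈-backSpots⁺ 0<u u<a a≤u+k) ou

pullbackPark-occupied : ∀ k ℓ n {occ : ℕ → Bool} {a} → occ a ≡ true →
                        pullbackPark k ℓ n occ a ≡ firstFree occ (backSpots a k ++ fwdSpots n a ℓ)
pullbackPark-occupied k ℓ n oa rewrite oa = refl

pullbackPark-backsInto⁺ : ∀ k ℓ n {occ : ℕ → Bool} {a u} →
                          occ a ≡ true → occ u ≡ false → 0 < u → u < a → a ≤ u + k →
                          (∀ {t} → u < t → t < a → occ t ≡ true) →
                          pullbackPark k ℓ n occ a ≡ just u
pullbackPark-backsInto⁺ k ℓ n {occ} {a} oa ou 0<u u<a a≤u+k occupied
  with v , found , u≤v ← firstFree-backSpots-≥ a k ou 0<u u<a a≤u+k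
  with v∈ , ov ← firstFree-sound (backSpots a k) found
  with m≤n⇒m<n∨m≡n u≤v
... | inj₂ refl = trans (pullbackPark-occupied k ℓ n oa) (firstFree-++ (backSpots a k) (fwdSpots n a ℓ) found)
... | inj₁ u<v  = contradiction (trans (sym ov) (occupied u<v (proj₁ (∈-backSpots⁻ a k v∈)))) λ ()

pullbackPark-backsInto⁻ : ∀ k ℓ n {occ : ℕ → Bool} {a u} →
                          u < a → pullbackPark k ℓ n occ a ≡ just u →
                          occ a ≡ true × a ≤ u + k × (∀ {t} → u < t → t < a → occ t ≡ true)
pullbackPark-backsInto⁻ k ℓ n {occ} {a} {u} u<a parked with occ a in oa
... | false = contradiction (just-injective parked) (>⇒≢ u<a)
... | true with u∈ , _ ← firstFree-sound (backSpots a k ++ fwdSpots n a ℓ) parked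
           with ∈-++⁻ (backSpots a k) u∈
...   | inj₂ u∈fwd  = contradiction u<a (<⇒≯ (∈-fwdSpots⁻ n a ℓ u∈fwd))
...   | inj₁ u∈back = refl , a≤u+k , occupied
  where
  a≤u+k : a ≤ u + k
  a≤u+k = proj₂ (∈-backSpots⁻ a k u∈back)
  -- A vacant t between u and a would be reached, descending from a, before u.
  occupied : ∀ {t} → u < t → t < a → occ t ≡ true
  occupied {t} u<t t<a with occ t in ot
  ... | true  = refl
  ... | false
    with v , found , t≤v ← firstFree-backSpots-≥ a k ot (≤-<-trans z≤n u<t) t<a
                             (≤-trans a≤u+k (+-monoˡ-≤ k (<⇒≤ u<t)))
    = contradiction (<-≤-trans u<t t≤v) (≤⇒≯ (≤-reflexive v≡u))
    where
    v≡u : v ≡ u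
    v≡u = just-injective (trans (sym (firstFree-++ (backSpots a k) (fwdSpots n a ℓ) found)) parked)

module _ (p : ℕ → Bool) (n : ℕ) where

  rightScan-≤ : ∀ t fuel → t ≤ suc n → t + rightScan p n t fuel ≤ suc n
  rightScan-≤ t zero       t≤1+n = subst (_≤ suc n) (sym (+-identityʳ t)) t≤1+n
  rightScan-≤ t (suc fuel) t≤1+n with (t ≤ᵇ n) ∧ p t in scan
  ... | false = subst (_≤ suc n) (sym (+-identityʳ t)) t≤1+n
  ... | true  = subst (_≤ suc n) (sym (+-suc t _)) (rightScan-≤ (suc t) fuel (s≤s t≤n))
    where
    t≤n : t ≤ n
    t≤n = ≤ᵇ⇒≤ t n (subst T (sym (∧-conicalˡ (t ≤ᵇ n) (p t) scan)) tt)

  rightScan-run : ∀ t fuel {u} → t ≤ u → u < t + rightScan p n t fuel → p u ≡ true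
  rightScan-run t zero       {u} t≤u u<t+0 =
    contradiction (subst (_≤ u) (sym (+-identityʳ t)) t≤u) (<⇒≱ u<t+0)
  rightScan-run t (suc fuel) {u} t≤u u<t+r with (t ≤ᵇ n) ∧ p t in scan
  ... | false = contradiction (subst (_≤ u) (sym (+-identityʳ t)) t≤u) (<⇒≱ u<t+r)
  ... | true with m≤n⇒m<n∨m≡n t≤u
  ...   | inj₂ refl = ∧-conicalʳ (t ≤ᵇ n) (p t) scan
  ...   | inj₁ t<u  = rightScan-run (suc t) fuel t<u (subst (u <_) (+-suc t _) u<t+r)

  rightScan-stop : ∀ t fuel → n < t + fuel → t + rightScan p n t fuel ≤ n →
                   p (t + rightScan p n t fuel) ≡ false
  rightScan-stop t zero       n<t+0    t+0≤n = contradiction t+0≤n (<⇒≱ n<t+0)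
  rightScan-stop t (suc fuel) n<t+fuel t+r≤n with (t ≤ᵇ n) ∧ p t in scan
  ... | false = trans (cong p (+-identityʳ t))
                      (trans (cong (_∧ p t) (sym (dec-true (t ≤? n) (≤-trans (m≤m+n t 0) t+r≤n)))) scan)
  ... | true  =
    trans (cong p (+-suc t (rightScan p n (suc t) fuel)))
      (rightScan-stop (suc t) fuel (subst (n <_) (+-suc t fuel) n<t+fuel) (subst (_≤ n) (+-suc t _) t+r≤n))

record MaximalRun (occ : ℕ → Bool) (n i r : ℕ) : Set where
  field
    bounded  : i + r ≤ n
    occupied : ∀ {t} → i < t → t ≤ i + r → occ t ≡ true
    vacant   : suc (i + r) ≤ n → occ (suc (i + r)) ≡ false

rightScan-maximalRun : ∀ occ n i → i ≤ n → MaximalRun occ n i (rightScan occ n (suc i) n)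
rightScan-maximalRun occ n i i≤n = record
  { bounded  = s≤s⁻¹ (rightScan-≤ occ n (suc i) n (s≤s i≤n))
  ; occupied = λ i<t t≤i+r → rightScan-run occ n (suc i) n i<t (s≤s t≤i+r)
  ; vacant   = rightScan-stop occ n (suc i) n (s≤s (m≤n+m n i))
  }

maximalRun-maximal : ∀ {occ : ℕ → Bool} {n i r a} → MaximalRun occ n i r →
                     occ a ≡ true → a ≤ n → (∀ {t} → i < t → t < a → occ t ≡ true) →
                     a ≤ i + r
maximalRun-maximal {i = i} {r} {a} run oa a≤n stretch with a ≤? i + r
... | yes a≤i+r = a≤i+r
... | no  a≰i+r with m≤n⇒m<n∨m≡n (≰⇒> a≰i+r)
...   | inj₁ end<a =
  contradiction (trans (sym (MaximalRun.vacant run (<⇒≤ (<-≤-trans end<a a≤n))))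
                       (stretch (s≤s (m≤m+n i r)) end<a)) λ ()
...   | inj₂ refl  = contradiction (trans (sym (MaximalRun.vacant run a≤n)) oa) λ ()

isJust≡-≢ : ∀ {mv i} → mv ≢ just i → isJust≡ mv i ≡ false
isJust≡-≢ {nothing}     _    = refl
isJust≡-≢ {just u} {i} u≢i = trans (isYes≗does (u ≟ i)) (dec-false (u ≟ i) (u≢i ∘ cong just))

isJust≡-refl : ∀ i → isJust≡ (just i) i ≡ true
isJust≡-refl i = trans (isYes≗does (i ≟ i)) (dec-true (i ≟ i) refl)

backsInto : (k ℓ n : ℕ) → (ℕ → Bool) → (i a : ℕ) → Bool
backsInto k ℓ n occ i a = occ a ∧ (i <ᵇ a) ∧ isJust≡ (pullbackPark k ℓ n occ a) i

module _ (k ℓ n : ℕ) {occ : ℕ → Bool} {i : ℕ} where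

  backsInto-≤ : ∀ {a} → a ≤ i → backsInto k ℓ n occ i a ≡ false
  backsInto-≤ {a} a≤i =
    trans (cong (λ b → occ a ∧ (b ∧ isJust≡ (pullbackPark k ℓ n occ a) i))
                (dec-false (i <? a) (≤⇒≯ a≤i)))
          (∧-zeroʳ (occ a))

  backsInto-within : ∀ {r} → occ i ≡ false → 0 < i → MaximalRun occ n i r →
                     ∀ {a} → i < a → a ≤ i + r ⊓ k → backsInto k ℓ n occ i a ≡ true
  backsInto-within {r} oi 0<i run {a} i<a a≤i+r⊓k =
    cong₂ _∧_ oa (cong₂ _∧_ (dec-true (i <? a) i<a)
                            (trans (cong (λ mv → isJust≡ mv i) parked) (isJust≡-refl i)))
    where
    open MaximalRun run
    a≤i+r : a ≤ i + r
    a≤i+r = ≤-trans a≤i+r⊓k (+-monoʳ-≤ i (m⊓n≤m r k))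
    oa : occ a ≡ true
    oa = occupied i<a a≤i+r
    parked : pullbackPark k ℓ n occ a ≡ just i
    parked = pullbackPark-backsInto⁺ k ℓ n oa oi 0<i i<a (≤-trans a≤i+r⊓k (+-monoʳ-≤ i (m⊓n≤n r k)))
               (λ i<t t<a → occupied i<t (≤-trans (<⇒≤ t<a) a≤i+r))

  backsInto-beyond : ∀ {r} → MaximalRun occ n i r →
                     ∀ {a} → i + r ⊓ k < a → a ≤ n → backsInto k ℓ n occ i a ≡ false
  backsInto-beyond {r} run {a} i+r⊓k<a a≤n =
    trans (cong₂ (λ b c → occ a ∧ (b ∧ c)) (dec-true (i <? a) i<a) (isJust≡-≢ not-parked))
          (∧-zeroʳ (occ a))
    where
    i<a : i < a
    i<a = ≤-<-trans (m≤m+n i (r ⊓ k)) i+r⊓k<a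
    not-parked : pullbackPark k ℓ n occ a ≢ just i
    not-parked parked with oa , a≤i+k , stretch ← pullbackPark-backsInto⁻ k ℓ n i<a parked =
      contradiction (subst (a ≤_) (sym (+-distribˡ-⊓ i r k))
                      (⊓-glb (maximalRun-maximal run oa a≤n stretch) a≤i+k))
                    (<⇒≱ i+r⊓k<a)

countB-backsInto : ∀ k ℓ n {occ : ℕ → Bool} {i r} → occ i ≡ false → 0 < i → MaximalRun occ n i r →
                   countB (backsInto k ℓ n occ i) (map suc (upTo n)) ≡ r ⊓ k
countB-backsInto k ℓ n {occ} {i} {r} oi 0<i run = begin
  countB P (map suc (upTo n))
    ≡⟨ cong (countB P) (map-upTo suc n) ⟩
  countB P (applyUpTo suc n)
    ≡⟨ cong (countB P ∘ applyUpTo suc) (sym i+m+rest≡n) ⟩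
  countB P (applyUpTo suc (i + m + (n ∸ (i + m))))
    ≡⟨ countB-applyUpTo-block P suc i m _ before within beyond ⟩
  m ∎
  where
  open ≡-Reasoning
  P : ℕ → Bool
  P = backsInto k ℓ n occ i
  m : ℕ
  m = r ⊓ k
  i+m+rest≡n : i + m + (n ∸ (i + m)) ≡ n
  i+m+rest≡n = m+[n∸m]≡n (≤-trans (+-monoʳ-≤ i (m⊓n≤m r k)) (MaximalRun.bounded run))
  before : ∀ {j} → j < i → P (suc j) ≡ false
  before = backsInto-≤ k ℓ n {occ}
  within : ∀ {j} → j < m → P (suc (i + j)) ≡ true
  within {j} j<m = backsInto-within k ℓ n oi 0<i run (s≤s (m≤m+n i j))
                     (subst (_≤ i + m) (+-suc i j) (+-monoʳ-≤ i j<m))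
  beyond : ∀ {j} → j < n ∸ (i + m) → P (suc (i + m + j)) ≡ false
  beyond {j} j<rest = backsInto-beyond k ℓ n run (s≤s (m≤m+n (i + m) j))
                        (subst₂ _≤_ (+-suc (i + m) j) i+m+rest≡n (+-monoʳ-≤ (i + m) j<rest))

occupiedBefore-≤ : ∀ {n} (π : Vec ℕ n) {c} u → c ≤ at (toList π) u → occupiedBefore π c u ≡ false
occupiedBefore-≤ π {c} u c≤π[u] =
  trans (cong ((0 <ᵇ at (toList π) u) ∧_) (dec-false (at (toList π) u <? c) (≤⇒≯ c≤π[u])))
        (∧-zeroʳ (0 <ᵇ at (toList π) u))

lemma2p11 : (k ℓ m n : ℕ) → 1 ≤ m → m ≤ n → (π : Vec ℕ n) → inS m n π →
            (i : ℕ) → 1 ≤ i → i ≤ n → 0 < at (toList π) i →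
            Bcount k ℓ n π i ≡ Right n π i ⊓ k
lemma2p11 k ℓ m n _ _ π _ i 1≤i i≤n _ =
  countB-backsInto k ℓ n (occupiedBefore-≤ π i ≤-refl) 1≤i (rightScan-maximalRun _ n i i≤n)
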